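{- Let $\alpha=(\alpha_1,\dots,\alpha_k)$ be a composition of $n$ with $\alpha_k=1$, and let $\sigma$ be an ordered set partition of $[n]$ of shape $\alpha$. Then $c.\pi(\sigma)=\pi(c.\sigma)$ as $k$-segmented permutations.
   Context: An ordered set partition $\sigma=(B_1|\dots|B_k)$ of $[n]$ has shape $(|B_1|,\dots,|B_k|)$. A $k$-segmented permutation is a pair $(\pi,\alpha)$ with $\pi\in S_n$ and $\alpha$ a composition of $n$ with $k$ parts, viewed as $\pi$ cut into consecutive segments $\pi[1],\dots,\pi[k]$ of lengths $\alpha_1,\dots,\alpha_k$. The map $\pi(\sigma)$: write $B_i=\{j^{(i)}_1<\cdots<j^{(i)}_{\alpha_i}\}$; $\pi[k]=j^{(k)}_1\cdots j^{(k)}_{\alpha_k}$; for $i=k-1,\dots,1$, with $r$ the first letter of $\pi[i+1]$ and $0\le m\le\alpha_i$ maximal with $j^{(i)}_m\le r$ ($j^{(i)}_0=-\infty$), set $\pi[i]=j^{(i)}_{m+1}\cdots j^{(i)}_{\alpha_i}j^{(i)}_1\cdots j^{(i)}_m$; then $\pi(\sigma)=(\pi[1]\cdots\pi[k],\alpha)$. Let $c(j)=j-1$ for $1<j\le n$ and $c(1)=n$; $c$ acts on ordered set partitions by applying $c$ to every element of every block, and on segmented permutations by $c.(\pi_1\cdots\pi_n,\alpha)=(c(\pi_1)\cdots c(\pi_n),\alpha)$. -}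

module Defs where

open import Data.Nat using (ℕ; zero; suc; _≤?_; _≟_)
open import Data.List using (List; []; _∷_; map; concat; length; filter; upTo; span; _++_; last)
open import Data.List.Membership.DecPropositional _≟_ using (_∈?_)
open import Data.List.Relation.Unary.All using (All)
open import Data.List.Relation.Binary.Permutation.Propositional using (_↭_)
open import Data.Product using (_×_; _,_)
open import Data.Maybe using (Maybe; just)
open import Relation.Binary.PropositionalEquality using (_≡_; _≢_)

range : ℕ → List ℕ
range n = map suc (upTo n)

-- A block is a finite subset of [n], given as a list of its elements.
-- An ordered set partition of [n] is a list of blocks (B₁ | … | Bₖ):
-- every block is nonempty and the concatenation of the blocks is a
-- permutation of [n] (so blocks are disjoint, duplicate-free, cover [n]).
NonEmpty : List ℕ → Set
NonEmpty B = B ≢ []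

IsOSP : ℕ → List (List ℕ) → Set
IsOSP n σ = All NonEmpty σ × (concat σ ↭ range n)

shape : List (List ℕ) → List ℕ
shape σ = map length σ

sortBlock : ℕ → List ℕ → List ℕ
sortBlock n B = filter (λ j → j ∈? B) (range n)

-- first letter of a segment (default 0 for the empty list, never used
-- for ordered set partitions since blocks are nonempty)
firstLetter : List ℕ → ℕ
firstLetter [] = 0
firstLetter (x ∷ _) = x

-- given the increasing list j₁ ⋯ j_α and r, with m maximal such that
-- j_m ≤ r, return j_{m+1} ⋯ j_α j₁ ⋯ j_m
rotateAt : ℕ → List ℕ → List ℕ
rotateAt r js with span (λ j → j ≤? r) js
... | (small , large) = large ++ small

segments : ℕ → List (List ℕ) → List (List ℕ)
segments n [] = []
segments n (B ∷ []) = sortBlock n B ∷ []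
segments n (B ∷ B' ∷ σ) with segments n (B' ∷ σ)
... | segs@(s ∷ _) = rotateAt (firstLetter s) (sortBlock n B) ∷ segs
... | [] = []   -- impossible: segments of a nonempty list is nonempty

-- a segmented permutation (π , α): the word π₁⋯πₙ and the composition α
SegPerm : Set
SegPerm = List ℕ × List ℕ

piMap : ℕ → List (List ℕ) → SegPerm
piMap n σ = concat (segments n σ) , shape σ

c : ℕ → ℕ → ℕ
c n zero = zero      -- outside [n], irrelevant
c n (suc zero) = n
c n (suc (suc j)) = suc j

cOSP : ℕ → List (List ℕ) → List (List ℕ)
cOSP n σ = map (map (c n)) σ

cSeg : ℕ → SegPerm → SegPerm
cSeg n (w , α) = map (c n) w , α

module Submission where

-- Each segment π[i] (i < k) is the sorted block Bᵢ rotated at the first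
-- letter r of π[i+1]; equivalently it lists Bᵢ in the cyclic order
-- r+1, …, n, 1, …, r of [n].  The shift c maps this cyclic order of [n]
-- onto the cyclic order starting after c(r) (the rotation of [n] at r goes
-- to the rotation of [n] at c(r)), and, being injective on [n], c commutes
-- with selecting the elements of a block.  Hence
--   c.(rotation of Bᵢ at r) = rotation of c(Bᵢ) at c(r),
-- which is exactly the recursion step of π(c.σ), since c(r) is the first
-- letter of c.π[i+1].  The last segment is a sorted singleton {x}, and
-- c.{x} = {c(x)} is again sorted; this is where αₖ = 1 is needed.

open import Defs
open import Data.Nat using (ℕ; zero; suc; _+_; _≤_; _<_; _≤?_; _≟_; z≤n; s≤s)
open import Data.Nat.Properties
  using (+-suc; +-identityʳ; ≤-refl; <⇒≤; <⇒≱; 1+n≰n; m≤m+n; ≤∧≢⇒<; m≤n⇒∃[o]m+o≡n)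
open import Data.List using (List; []; _∷_; [_]; map; concat; filter; upTo; span; _++_; last)
open import Data.List.Properties
  using (map-++; ++-assoc; ++-identityʳ; concat-map; length-map; map-∘; map-cong;
         filter-accept; filter-reject; filter-none; filter-++; upTo-∷ʳ; takeWhile++dropWhile; span-defn)
open import Data.List.Membership.DecPropositional _≟_ using (_∈?_)
open import Data.List.Membership.Propositional using (_∈_)
open import Data.List.Membership.Propositional.Properties using (∈-map⁺; ∈-map⁻; ∈-filter⁺; ∈-upTo⁺)
open import Data.List.Relation.Unary.All using (All; []; _∷_; lookup; zip) renaming (map to all-map)
open import Data.List.Relation.Unary.All.Properties using (filter⁺; concat⁻; all-upTo) renaming (map⁺ to all-map⁺)
open import Data.List.Relation.Unary.Any using (here; there)
open import Data.List.Relation.Binary.Permutation.Propositional using (_↭_; ↭-sym)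
open import Data.List.Relation.Binary.Permutation.Propositional.Properties
  using (All-resp-↭; ↭-empty-inv; ++-comm)
open import Data.Product using (_×_; _,_; proj₁; proj₂; Σ-syntax)
import Data.Product as Product
open import Data.Maybe using (just)
open import Data.Empty using (⊥-elim)
open import Function using (id; _∘_)
open import Relation.Nullary using (¬_; yes; no)
open import Relation.Unary using (Pred; Decidable)
open import Relation.Binary.PropositionalEquality
  using (_≡_; refl; sym; trans; cong; cong₂; subst; module ≡-Reasoning)
open ≡-Reasoning

-- ivl a k = a+1 , … , a+k, the interval in which [n] = ivl 0 n and its
-- rotations are computed
ivl : ℕ → ℕ → List ℕ
ivl a zero    = []
ivl a (suc k) = suc a ∷ ivl (suc a) k

ivl-snoc : ∀ a k → ivl a (suc k) ≡ ivl a k ++ [ suc (a + k) ]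
ivl-snoc a zero    = cong (λ m → [ suc m ]) (sym (+-identityʳ a))
ivl-snoc a (suc k) = cong (suc a ∷_) (trans (ivl-snoc (suc a) k) (cong (λ m → ivl (suc a) k ++ [ suc m ]) (sym (+-suc a k))))

ivl-split : ∀ a k m → ivl a (k + m) ≡ ivl a k ++ ivl (a + k) m
ivl-split a zero    m = cong (λ b → ivl b m) (sym (+-identityʳ a))
ivl-split a (suc k) m = cong (suc a ∷_) (trans (ivl-split (suc a) k m) (cong (λ b → ivl (suc a) k ++ ivl b m) (sym (+-suc a k))))

ivl-bounds : ∀ a k → All (λ x → a < x × x ≤ a + k) (ivl a k)
ivl-bounds a zero    = []
ivl-bounds a (suc k) = (≤-refl , subst (suc a ≤_) (sym (+-suc a k)) (s≤s (m≤m+n a k)))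
  ∷ all-map (λ { {x} (a<x , x≤) → <⇒≤ a<x , subst (x ≤_) (sym (+-suc a k)) x≤ }) (ivl-bounds (suc a) k)

range≡ivl : ∀ n → range n ≡ ivl 0 n
range≡ivl zero    = refl
range≡ivl (suc n) = begin
  map suc (upTo (suc n))      ≡⟨ cong (map suc) (sym (upTo-∷ʳ n)) ⟩
  map suc (upTo n ++ [ n ])   ≡⟨ map-++ suc (upTo n) [ n ] ⟩
  range n ++ [ suc n ]        ≡⟨ cong (_++ [ suc n ]) (range≡ivl n) ⟩
  ivl 0 n ++ [ suc n ]        ≡⟨ sym (ivl-snoc 0 n) ⟩
  ivl 0 (suc n)               ∎

range-split : ∀ r t → range (r + t) ≡ ivl 0 r ++ ivl r t
range-split r t = trans (range≡ivl (r + t)) (ivl-split 0 r t)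

ivl-below : ∀ r → All (_≤ r) (ivl 0 r)
ivl-below r = all-map proj₂ (ivl-bounds 0 r)

ivl-above : ∀ r t → All (r <_) (ivl r t)
ivl-above r t = all-map proj₁ (ivl-bounds r t)

filter-singleton-ivl : ∀ x a k → a < x → x ≤ a + k → filter (_∈? [ x ]) (ivl a k) ≡ [ x ]
filter-singleton-ivl x a zero    a<x x≤ = ⊥-elim (<⇒≱ a<x (subst (x ≤_) (+-identityʳ a) x≤))
filter-singleton-ivl x a (suc k) a<x x≤ with suc a ≟ x
... | yes refl = trans (filter-accept (_∈? [ x ]) (here refl))
                       (cong (x ∷_) (filter-none (_∈? [ x ]) (all-map ≢x (ivl-bounds x k))))
  where
  ≢x : ∀ {y} → x < y × y ≤ x + k → ¬ (y ∈ [ x ])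
  ≢x (x<y , _) (here refl) = 1+n≰n x<y
... | no a+1≢x = trans (filter-reject (_∈? [ x ]) λ { (here eq) → a+1≢x eq })
                       (filter-singleton-ivl x (suc a) k (≤∧≢⇒< a<x a+1≢x) (subst (x ≤_) (+-suc a k) x≤))

span-threshold : ∀ {a p} {A : Set a} {P : Pred A p} (P? : Decidable P) xs ys →
                 All P xs → All (¬_ ∘ P) ys → span P? (xs ++ ys) ≡ (xs , ys)
span-threshold P? []       []       _          _          = refl
span-threshold P? []       (y ∷ ys) _          (¬py ∷ _) with P? y
... | yes py = ⊥-elim (¬py py)
... | no _   = refl
span-threshold P? (x ∷ xs) ys       (px ∷ pxs) ¬pys with P? x
... | yes _  = cong (Product.map (x ∷_) id) (span-threshold P? xs ys pxs ¬pys)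
... | no ¬px = ⊥-elim (¬px px)

rotate-threshold : ∀ r xs ys → All (_≤ r) xs → All (r <_) ys → rotateAt r (xs ++ ys) ≡ ys ++ xs
rotate-threshold r xs ys xs≤r r<ys =
  cong (λ p → proj₂ p ++ proj₁ p) (span-threshold (_≤? r) xs ys xs≤r (all-map <⇒≱ r<ys))

rotate-all-small : ∀ r xs → All (_≤ r) xs → rotateAt r xs ≡ xs
rotate-all-small r xs xs≤r =
  trans (cong (rotateAt r) (sym (++-identityʳ xs))) (rotate-threshold r xs [] xs≤r [])

rotate-↭ : ∀ r xs → rotateAt r xs ↭ xs
rotate-↭ r xs = subst (rotateAt r xs ↭_) split (++-comm large small)
  where
  small large : List ℕ
  small = proj₁ (span (_≤? r) xs)
  large = proj₂ (span (_≤? r) xs)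
  split : small ++ large ≡ xs
  split = trans (cong (λ p → proj₁ p ++ proj₂ p) (span-defn (_≤? r) xs)) (takeWhile++dropWhile (_≤? r) xs)

rotate-filter : ∀ {p} {P : Pred ℕ p} (P? : Decidable P) r xs ys → All (_≤ r) xs → All (r <_) ys →
                rotateAt r (filter P? (xs ++ ys)) ≡ filter P? (rotateAt r (xs ++ ys))
rotate-filter P? r xs ys xs≤r r<ys = begin
  rotateAt r (filter P? (xs ++ ys))           ≡⟨ cong (rotateAt r) (filter-++ P? xs ys) ⟩
  rotateAt r (filter P? xs ++ filter P? ys)   ≡⟨ rotate-threshold r _ _ (filter⁺ P? xs≤r) (filter⁺ P? r<ys) ⟩
  filter P? ys ++ filter P? xs                ≡⟨ sym (filter-++ P? ys xs) ⟩
  filter P? (ys ++ xs)                        ≡⟨ cong (filter P?) (sym (rotate-threshold r xs ys xs≤r r<ys)) ⟩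
  filter P? (rotateAt r (xs ++ ys))           ∎

rotate-range : ∀ r t → rotateAt r (range (r + t)) ≡ ivl r t ++ ivl 0 r
rotate-range r t = trans (cong (rotateAt r) (range-split r t)) (rotate-threshold r _ _ (ivl-below r) (ivl-above r t))

rotate-filter-range : ∀ {p} {P : Pred ℕ p} (P? : Decidable P) {n} r → r ≤ n →
                      rotateAt r (filter P? (range n)) ≡ filter P? (rotateAt r (range n))
rotate-filter-range P? r r≤n with m≤n⇒∃[o]m+o≡n r≤n
... | t , refl rewrite range-split r t = rotate-filter P? r _ _ (ivl-below r) (ivl-above r t)

filter-∈-map : ∀ (f : ℕ → ℕ) {d} {D : Pred ℕ d} → (∀ {x y} → D x → D y → f x ≡ f y → x ≡ y) →
               ∀ B L → All D B → All D L → filter (_∈? map f B) (map f L) ≡ map f (filter (_∈? B) L)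
filter-∈-map f inj B []      DB []         = refl
filter-∈-map f inj B (x ∷ L) DB (Dx ∷ DL) with x ∈? B
... | yes x∈B = trans (filter-accept (_∈? map f B) (∈-map⁺ f x∈B)) (cong (f x ∷_) (filter-∈-map f inj B L DB DL))
... | no x∉B  = trans (filter-reject (_∈? map f B) fx∉fB) (filter-∈-map f inj B L DB DL)
  where
  fx∉fB : ¬ (f x ∈ map f B)
  fx∉fB fx∈fB with ∈-map⁻ f fx∈fB
  ... | y , y∈B , fx≡fy = x∉B (subst (_∈ B) (sym (inj Dx (lookup DB y∈B) fx≡fy)) y∈B)

InRange : ℕ → ℕ → Set
InRange n x = 1 ≤ x × x ≤ n

range-inRange : ∀ n → All (InRange n) (range n)
range-inRange n = all-map⁺ (all-map (λ i<n → s≤s z≤n , i<n) (all-upTo n))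

inRange⇒∈range : ∀ {n x} → InRange n x → x ∈ range n
inRange⇒∈range {x = suc i} (_ , i<n) = ∈-map⁺ suc (∈-upTo⁺ i<n)

c-inRange : ∀ {n x} → InRange n x → InRange n (c n x)
c-inRange {x = suc zero}    (_ , 1≤n)  = 1≤n , ≤-refl
c-inRange {x = suc (suc j)} (_ , x≤n)  = s≤s z≤n , <⇒≤ x≤n

c-injective : ∀ {n x y} → InRange n x → InRange n y → c n x ≡ c n y → x ≡ y
c-injective {x = suc zero}    {suc zero}    _          _          _  = refl
c-injective {x = suc zero}    {suc (suc j)} _          (_ , y≤n)  eq = ⊥-elim (1+n≰n (subst (suc (suc j) ≤_) eq y≤n))
c-injective {x = suc (suc i)} {suc zero}    (_ , x≤n)  _          eq = ⊥-elim (1+n≰n (subst (suc (suc i) ≤_) (sym eq) x≤n))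
c-injective {x = suc (suc i)} {suc (suc j)} _          _          eq = cong suc eq

c-ivl : ∀ n a k → map (c n) (ivl (suc a) k) ≡ ivl a k
c-ivl n a zero    = refl
c-ivl n a (suc k) = cong (suc a ∷_) (c-ivl n (suc a) k)

c-rotate-range : ∀ {n r} → InRange n r → map (c n) (rotateAt r (range n)) ≡ rotateAt (c n r) (range n)
c-rotate-range {zero}  {suc zero}    (_ , ())
c-rotate-range {suc m} {suc zero}    _ = begin
  map (c (suc m)) (rotateAt 1 (range (suc m)))     ≡⟨ cong (map (c (suc m))) (rotate-range 1 m) ⟩
  map (c (suc m)) (ivl 1 m ++ [ 1 ])               ≡⟨ map-++ (c (suc m)) (ivl 1 m) [ 1 ] ⟩
  map (c (suc m)) (ivl 1 m) ++ [ suc m ]           ≡⟨ cong (_++ [ suc m ]) (c-ivl (suc m) 0 m) ⟩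
  ivl 0 m ++ [ suc m ]                             ≡⟨ sym (ivl-snoc 0 m) ⟩
  ivl 0 (suc m)                                    ≡⟨ sym (range≡ivl (suc m)) ⟩
  range (suc m)                                    ≡⟨ sym (rotate-all-small (suc m) _ (all-map proj₂ (range-inRange (suc m)))) ⟩
  rotateAt (suc m) (range (suc m))                 ∎
c-rotate-range {n}     {suc (suc s)} (_ , r≤n) with m≤n⇒∃[o]m+o≡n r≤n
... | t , refl = begin
  map (c n) (rotateAt (suc (suc s)) (range n))                 ≡⟨ cong (map (c n)) (rotate-range (suc (suc s)) t) ⟩
  map (c n) (ivl (suc (suc s)) t ++ ivl 0 (suc (suc s)))       ≡⟨ map-++ (c n) (ivl (suc (suc s)) t) _ ⟩
  map (c n) (ivl (suc (suc s)) t) ++ n ∷ map (c n) (ivl 1 (suc s))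
    ≡⟨ cong₂ (λ u v → u ++ n ∷ v) (c-ivl n (suc s) t) (c-ivl n 0 (suc s)) ⟩
  ivl (suc s) t ++ n ∷ ivl 0 (suc s)                           ≡⟨ sym (++-assoc (ivl (suc s) t) [ n ] _) ⟩
  (ivl (suc s) t ++ [ n ]) ++ ivl 0 (suc s)                    ≡⟨ cong (_++ ivl 0 (suc s)) (sym (ivl-snoc (suc s) t)) ⟩
  ivl (suc s) (suc t) ++ ivl 0 (suc s)                         ≡⟨ sym (rotate-range (suc s) (suc t)) ⟩
  rotateAt (suc s) (range (suc s + suc t))                     ≡⟨ cong (rotateAt (suc s) ∘ range) (+-suc (suc s) t) ⟩
  rotateAt (suc s) (range n)                                   ∎

c-rotate-sortBlock : ∀ {n r} B → InRange n r → All (InRange n) B →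
                     map (c n) (rotateAt r (sortBlock n B)) ≡ rotateAt (c n r) (sortBlock n (map (c n) B))
c-rotate-sortBlock {n} {r} B r∈ B⊆ = begin
  map (c n) (rotateAt r (filter (_∈? B) (range n)))       ≡⟨ cong (map (c n)) (rotate-filter-range (_∈? B) r (proj₂ r∈)) ⟩
  map (c n) (filter (_∈? B) (rotateAt r (range n)))       ≡⟨ sym (filter-∈-map (c n) c-injective B _ B⊆ rotation⊆) ⟩
  filter (_∈? cB) (map (c n) (rotateAt r (range n)))      ≡⟨ cong (filter (_∈? cB)) (c-rotate-range r∈) ⟩
  filter (_∈? cB) (rotateAt (c n r) (range n))            ≡⟨ sym (rotate-filter-range (_∈? cB) (c n r) (proj₂ (c-inRange r∈))) ⟩
  rotateAt (c n r) (filter (_∈? cB) (range n))            ∎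
  where
  cB = map (c n) B
  rotation⊆ : All (InRange n) (rotateAt r (range n))
  rotation⊆ = All-resp-↭ (↭-sym (rotate-↭ r (range n))) (range-inRange n)

sortBlock-singleton : ∀ {n x} → InRange n x → sortBlock n [ x ] ≡ [ x ]
sortBlock-singleton {n} {x} (1≤x , x≤n) = trans (cong (filter (_∈? [ x ])) (range≡ivl n)) (filter-singleton-ivl x 0 n 1≤x x≤n)

module Segments (n : ℕ) where

  Proper : List ℕ → Set
  Proper B = NonEmpty B × All (InRange n) B

  proper-firstLetter : ∀ {s} → Proper s → InRange n (firstLetter s)
  proper-firstLetter {[]}    (s≢[] , _)     = ⊥-elim (s≢[] refl)
  proper-firstLetter {_ ∷ _} (_ , x∈ ∷ _)   = x∈

  proper-↭ : ∀ {xs ys} → xs ↭ ys → Proper ys → Proper xs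
  proper-↭ {ys = ys} xs↭ys (ys≢[] , ys⊆) =
    (λ xs≡[] → ys≢[] (↭-empty-inv (↭-sym (subst (_↭ ys) xs≡[] xs↭ys)))) , All-resp-↭ (↭-sym xs↭ys) ys⊆

  proper-sortBlock : ∀ {B} → Proper B → Proper (sortBlock n B)
  proper-sortBlock {[]}    (B≢[] , _)   = ⊥-elim (B≢[] refl)
  proper-sortBlock {x ∷ B} (_ , x∈ ∷ _) = nonempty x∈sorted , filter⁺ (_∈? x ∷ B) (range-inRange n)
    where
    x∈sorted : x ∈ sortBlock n (x ∷ B)
    x∈sorted = ∈-filter⁺ (_∈? x ∷ B) (inRange⇒∈range x∈) (here refl)
    nonempty : ∀ {y ys} → y ∈ ys → NonEmpty ys
    nonempty (here _)  ()
    nonempty (there _) ()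

  segments-step : ∀ B B' σ {s rest} → segments n (B' ∷ σ) ≡ s ∷ rest →
                  segments n (B ∷ B' ∷ σ) ≡ rotateAt (firstLetter s) (sortBlock n B) ∷ s ∷ rest
  segments-step B B' σ eq rewrite eq = refl

  segments-head : ∀ B σ → All Proper (B ∷ σ) →
                  Σ[ s ∈ List ℕ ] Σ[ rest ∈ List (List ℕ) ] (segments n (B ∷ σ) ≡ s ∷ rest × Proper s)
  segments-head B []        (B-ok ∷ [])  = sortBlock n B , [] , refl , proper-sortBlock B-ok
  segments-head B (B' ∷ σ)  (B-ok ∷ σ-ok) with segments-head B' σ σ-ok
  ... | s , rest , eq , _ =
    rotateAt (firstLetter s) (sortBlock n B) , s ∷ rest , segments-step B B' σ eq ,
    proper-↭ (rotate-↭ (firstLetter s) (sortBlock n B)) (proper-sortBlock B-ok)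

  firstLetter-c : ∀ s → firstLetter (map (c n) s) ≡ c n (firstLetter s)
  firstLetter-c []      = refl
  firstLetter-c (_ ∷ _) = refl

  segments-c : ∀ σ → All Proper σ → last (shape σ) ≡ just 1 →
               map (map (c n)) (segments n σ) ≡ segments n (cOSP n σ)
  segments-c []                  _                      ()
  segments-c ([] ∷ [])           _                      ()
  segments-c ((x ∷ []) ∷ [])     ((_ , x∈ ∷ []) ∷ [])   _ =
    cong [_] (trans (cong (map (c n)) (sortBlock-singleton x∈)) (sym (sortBlock-singleton (c-inRange x∈))))
  segments-c ((_ ∷ _ ∷ _) ∷ [])  _                      ()
  segments-c (B ∷ B' ∷ σ)        ((_ , B⊆) ∷ σ-ok)      last≡1 with segments-head B' σ σ-ok
  ... | s , rest , eq , s-ok = begin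
    map (map (c n)) (segments n (B ∷ B' ∷ σ))
      ≡⟨ cong (map (map (c n))) (segments-step B B' σ eq) ⟩
    map (c n) (rotateAt (firstLetter s) (sortBlock n B)) ∷ map (map (c n)) (s ∷ rest)
      ≡⟨ cong (_∷ _) (c-rotate-sortBlock B (proper-firstLetter s-ok) B⊆) ⟩
    rotateAt (c n (firstLetter s)) (sortBlock n (map (c n) B)) ∷ map (map (c n)) (s ∷ rest)
      ≡⟨ cong (λ r → rotateAt r (sortBlock n (map (c n) B)) ∷ map (map (c n)) (s ∷ rest)) (sym (firstLetter-c s)) ⟩
    rotateAt (firstLetter (map (c n) s)) (sortBlock n (map (c n) B)) ∷ map (map (c n)) (s ∷ rest)
      ≡⟨ sym (segments-step (map (c n) B) (map (c n) B') (cOSP n σ) c-eq) ⟩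
    segments n (cOSP n (B ∷ B' ∷ σ))
      ∎
    where
    c-eq : segments n (cOSP n (B' ∷ σ)) ≡ map (c n) s ∷ map (map (c n)) rest
    c-eq = trans (sym (segments-c (B' ∷ σ) σ-ok last≡1)) (cong (map (map (c n))) eq)

open Segments using (Proper; segments-c)

shape-map : ∀ (f : ℕ → ℕ) σ → shape (map (map f) σ) ≡ shape σ
shape-map f σ = trans (sym (map-∘ σ)) (map-cong (length-map f) σ)

lemma2p5 : (n : ℕ) (σ : List (List ℕ)) → IsOSP n σ → last (shape σ) ≡ just 1 →
    cSeg n (piMap n σ) ≡ piMap n (cOSP n σ)
lemma2p5 n σ (nonempty , σ↭[n]) last≡1 = cong₂ _,_ words (sym (shape-map (c n) σ))
  where
  proper : All (Proper n) σ
  proper = zip (nonempty , concat⁻ (All-resp-↭ (↭-sym σ↭[n]) (range-inRange n)))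
  words : map (c n) (concat (segments n σ)) ≡ concat (segments n (cOSP n σ))
  words = trans (sym (concat-map (segments n σ))) (cong concat (segments-c n σ proper last≡1))
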